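{- Let $p>3$ be a prime. Define the rational number \[\beta(p) = \sum_{r=1}^{p-1}\frac{(3p+1)!!!}{(3r+4)!!!}\sum_{n=1}^{r-1}\frac{(3r+3)!!!}{(3n+3)!!!}\left((3n+2)!!! + \sum_{j=1}^{n-1}\frac{(3j+1)!!!\,(3n+2)!!!}{(3j+2)!!!}\right).\] Then $\beta(p)$ has denominator prime to $p$ and $\beta(p) \equiv -1 \pmod p$, i.e. $\beta(p) = -1$ in $\mathbb{F}_p$.
   Context: The triple factorial $n!!!$ for integers $n \geq 0$ is defined by $0!!! = 1!!! = 2!!! = 1$ and $n!!! = n \cdot (n-3)!!!$ for $n \geq 3$. Empty sums (upper index smaller than lower index) are $0$. -}

module Defs where

open import Data.Nat as ℕ using (ℕ; zero; suc; _+_; _*_; _∸_; NonZero)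
open import Data.Nat.Properties using (m*n≢0)
open import Data.Integer using (ℤ; +_)
open import Data.Rational as ℚ using (ℚ; _/_; 0ℚ)

tf : ℕ → ℕ
tf 0 = 1
tf 1 = 1
tf 2 = 1
tf (suc (suc (suc n))) = suc (suc (suc n)) * tf n

tf-nonZero : ∀ n → NonZero (tf n)
tf-nonZero 0 = _
tf-nonZero 1 = _
tf-nonZero 2 = _
tf-nonZero (suc (suc (suc n))) = m*n≢0 (suc (suc (suc n))) (tf n) {{_}} {{tf-nonZero n}}

_/tf_ : ℕ → ℕ → ℚ
a /tf m = (+ a) / tf m
  where instance _ = tf-nonZero m

-- Σ_{i=a}^{b} f i  (empty, i.e. 0, when b < a)
Σ[_⋯_] : ℕ → ℕ → (ℕ → ℚ) → ℚ
Σ[ a ⋯ b ] f = go a (suc b ∸ a)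
  where
  go : ℕ → ℕ → ℚ
  go i zero = 0ℚ
  go i (suc k) = f i ℚ.+ go (suc i) k

inner : ℕ → ℚ
inner n = (tf (3 * n + 2) /tf 0)
  ℚ.+ Σ[ 1 ⋯ n ∸ 1 ] (λ j → (tf (3 * j + 1) * tf (3 * n + 2)) /tf (3 * j + 2))

β : ℕ → ℚ
β p = Σ[ 1 ⋯ p ∸ 1 ] (λ r →
        (tf (3 * p + 1) /tf (3 * r + 4)) ℚ.*
        Σ[ 1 ⋯ r ∸ 1 ] (λ n → (tf (3 * r + 3) /tf (3 * n + 3)) ℚ.* inner n))

-- Every ratio of triple factorials in β(p) is a product of terms of an arithmetic
-- progression, so β(p) is a natural number. With T_c(n) = (3n + c)!!!, each of the three
-- nested sums has the shape W(m) = Σ_{j=1}^{m} (T_c(m) / T_c(j)) h(j), which satisfies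
-- W(m + 1) = (3m + 3 + c) W(m) + h(m + 1). Solving these recurrences one after the other
-- gives, with β(n + 1) = S₃(n),
--   16 S₃(n) + A(n) T₁(n) + B(n) T₂(n) = C(n) T₁(n) + D(n) T₃(n) + 16 G(n),
--   G(n) = Σ_{s=1}^{n} T₁(s) T₄(n) / T₄(s),
-- for explicit polynomials A, B, C, D. Let 0 < k, k′ < p with p ∣ 3k + 1 and p ∣ 3k′ + 2.
-- At n = p - 1 the factors 3k + 1, 3k′ + 2 and 3p make T₁, T₂, T₃ divisible by p, and
-- so is every summand of G except s = k - 1, which equals (3p + 1) ∏_{i < p, i ≠ k} (3i + 1).
-- Wilson's pairing argument for the progression 3i + 1 makes that product ≡ -1, hence
-- 16 β(p) ≡ -16 (mod p).

module Submission where

open import Algebra.Bundles using (CommutativeMonoid)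

module Product {c ℓ} (M : CommutativeMonoid c ℓ) where

  open import Data.Nat as ℕ using (ℕ; zero; suc; _<_; _≤_; _<?_)
  import Data.Nat.Properties as ℕ
  open import Data.Sum using (inj₁; inj₂)
  open import Relation.Binary.Definitions using (tri<; tri≈; tri>)
  open import Relation.Binary.PropositionalEquality as ≡ using (_≡_; _≢_)
  open import Relation.Nullary using (yes; no; ¬_; contradiction)

  open CommutativeMonoid M
  open import Algebra.Properties.CommutativeSemigroup commutativeSemigroup
    using (xy∙z≈y∙xz; xy∙z≈xz∙y; xy∙z≈zx∙y)
  open import Relation.Binary.Reasoning.Setoid setoid

  ∏< : ℕ → (ℕ → Carrier) → Carrier
  ∏< zero v = ε
  ∏< (suc n) v = ∏< n v ∙ v n

  ∏<-cong : ∀ n {u v : ℕ → Carrier} → (∀ {i} → i < n → u i ≈ v i) → ∏< n u ≈ ∏< n v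
  ∏<-cong zero eq = refl
  ∏<-cong (suc n) eq = ∙-cong (∏<-cong n (λ i<n → eq (ℕ.m<n⇒m<1+n i<n))) (eq ℕ.≤-refl)

  ∏<-exchange : ∀ n {u v : ℕ → Carrier} {j} → j < n → (∀ {i} → i < n → i ≢ j → u i ≈ v i) →
                ∏< n u ∙ v j ≈ u j ∙ ∏< n v
  ∏<-exchange (suc n) {u} {v} {j} j<1+n eq with ℕ.m≤n⇒m<n∨m≡n (ℕ.s≤s⁻¹ j<1+n)
  ... | inj₂ ≡.refl = begin
    ∏< j u ∙ u j ∙ v j
      ≈⟨ ∙-congʳ (∙-congʳ (∏<-cong j (λ i<j → eq (ℕ.m<n⇒m<1+n i<j) (ℕ.<⇒≢ i<j)))) ⟩
    ∏< j v ∙ u j ∙ v j ≈⟨ xy∙z≈y∙xz _ _ _ ⟩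
    u j ∙ (∏< j v ∙ v j) ∎
  ... | inj₁ j<n = begin
    ∏< n u ∙ u n ∙ v j ≈⟨ xy∙z≈xz∙y _ _ _ ⟩
    ∏< n u ∙ v j ∙ u n ≈⟨ ∙-cong (∏<-exchange n j<n (λ i<n → eq (ℕ.m<n⇒m<1+n i<n)))
                                (eq ℕ.≤-refl (λ n≡j → ℕ.<-irrefl (≡.sym n≡j) j<n)) ⟩
    u j ∙ ∏< n v ∙ v n ≈⟨ assoc _ _ _ ⟩
    u j ∙ (∏< n v ∙ v n) ∎

  module _ {n : ℕ} {f : ℕ → ℕ} {v : ℕ → Carrier}
           (f-closed : ∀ {i} → i < n → f i < n) (f-involutive : ∀ {i} → i < n → f (f i) ≡ i)
           (fixed : ∀ {i} → i < n → f i ≡ i → v i ≈ ε)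
           (paired : ∀ {i} → i < n → f i ≢ i → v i ∙ v (f i) ≈ ε) where

    private
      -- The factors v i whose partner f i lies below m; they enter the product in pairs.
      settled : ℕ → ℕ → Carrier
      settled m i with f i <? m
      ... | yes _ = v i
      ... | no _ = ε

      settled-yes : ∀ {m i} → f i < m → settled m i ≡ v i
      settled-yes {m} {i} fi<m with f i <? m
      ... | yes _ = ≡.refl
      ... | no fi≮m = contradiction fi<m fi≮m

      settled-no : ∀ {m i} → ¬ f i < m → settled m i ≡ ε
      settled-no {m} {i} fi≮m with f i <? m
      ... | yes fi<m = contradiction fi<m fi≮m
      ... | no _ = ≡.refl

      settled-suc : ∀ {m i} → f i ≢ m → settled (suc m) i ≡ settled m i
      settled-suc {m} {i} fi≢m with f i <? suc m | f i <? m
      ... | yes _ | yes _ = ≡.refl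
      ... | no _ | no _ = ≡.refl
      ... | no fi≮1+m | yes fi<m = contradiction (ℕ.m<n⇒m<1+n fi<m) fi≮1+m
      ... | yes fi<1+m | no fi≮m with ℕ.m≤n⇒m<n∨m≡n (ℕ.s≤s⁻¹ fi<1+m)
      ...   | inj₁ fi<m = contradiction fi<m fi≮m
      ...   | inj₂ fi≡m = contradiction fi≡m fi≢m

      f-inverse : ∀ {i m} → i < n → f i ≡ m → i ≡ f m
      f-inverse i<n ≡.refl = ≡.sym (f-involutive i<n)

      settled-unchanged : ∀ {m} → m < n → ∀ {i} → i < m → i ≢ f m → settled (suc m) i ≈ settled m i
      settled-unchanged m<n i<m i≢fm =
        reflexive (settled-suc (λ fi≡m → i≢fm (f-inverse (ℕ.<-trans i<m m<n) fi≡m)))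

      settled-step : ∀ {m} → m < n → ∏< (suc m) (settled (suc m)) ≈ ∏< m (settled m)
      settled-step {m} m<n with ℕ.<-cmp (f m) m
      ... | tri≈ _ fm≡m _ = begin
        ∏< m (settled (suc m)) ∙ settled (suc m) m
          ≈⟨ ∙-cong (∏<-cong m unchanged) (reflexive (settled-yes (ℕ.s≤s (ℕ.≤-reflexive fm≡m)))) ⟩
        ∏< m (settled m) ∙ v m ≈⟨ ∙-congˡ (fixed m<n fm≡m) ⟩
        ∏< m (settled m) ∙ ε   ≈⟨ identityʳ _ ⟩
        ∏< m (settled m)       ∎
        where
        unchanged : ∀ {i} → i < m → settled (suc m) i ≈ settled m i
        unchanged i<m = settled-unchanged m<n i<m (λ i≡fm → ℕ.<⇒≢ i<m (≡.trans i≡fm fm≡m))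
      ... | tri> _ _ m<fm = begin
        ∏< m (settled (suc m)) ∙ settled (suc m) m
          ≈⟨ ∙-cong (∏<-cong m unchanged)
                    (reflexive (settled-no (λ fm<1+m → ℕ.<⇒≱ m<fm (ℕ.s≤s⁻¹ fm<1+m)))) ⟩
        ∏< m (settled m) ∙ ε ≈⟨ identityʳ _ ⟩
        ∏< m (settled m)     ∎
        where
        unchanged : ∀ {i} → i < m → settled (suc m) i ≈ settled m i
        unchanged i<m = settled-unchanged m<n i<m (λ i≡fm → ℕ.<-asym i<m (≡.subst (m <_) (≡.sym i≡fm) m<fm))
      ... | tri< fm<m _ _ = begin
        ∏< m (settled (suc m)) ∙ settled (suc m) m
          ≈⟨ ∙-congˡ (reflexive (settled-yes (ℕ.m<n⇒m<1+n fm<m))) ⟩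
        ∏< m (settled (suc m)) ∙ v m                     ≈⟨ ∙-congʳ (identityʳ _) ⟨
        ∏< m (settled (suc m)) ∙ ε ∙ v m
          ≈⟨ ∙-congʳ (∙-congˡ (reflexive (settled-no (ℕ.<-irrefl ffm≡m)))) ⟨
        ∏< m (settled (suc m)) ∙ settled m (f m) ∙ v m
          ≈⟨ ∙-congʳ (∏<-exchange m fm<m (settled-unchanged m<n)) ⟩
        settled (suc m) (f m) ∙ ∏< m (settled m) ∙ v m
          ≈⟨ ∙-congʳ (∙-congʳ (reflexive (settled-yes (ℕ.s≤s (ℕ.≤-reflexive ffm≡m))))) ⟩
        v (f m) ∙ ∏< m (settled m) ∙ v m                 ≈⟨ xy∙z≈zx∙y _ _ _ ⟩
        v m ∙ v (f m) ∙ ∏< m (settled m)                 ≈⟨ ∙-congʳ (paired m<n (ℕ.<⇒≢ fm<m)) ⟩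
        ε ∙ ∏< m (settled m)                             ≈⟨ identityˡ _ ⟩
        ∏< m (settled m)                                 ∎
        where
        ffm≡m : f (f m) ≡ m
        ffm≡m = f-involutive m<n

      ∏<-settled : ∀ m → m ≤ n → ∏< m (settled m) ≈ ε
      ∏<-settled zero _ = refl
      ∏<-settled (suc m) m<n = trans (settled-step m<n) (∏<-settled m (ℕ.<⇒≤ m<n))

    ∏<-involution : ∏< n v ≈ ε
    ∏<-involution = begin
      ∏< n v           ≈⟨ ∏<-cong n (λ i<n → reflexive (settled-yes (f-closed i<n))) ⟨
      ∏< n (settled n) ≈⟨ ∏<-settled n ℕ.≤-refl ⟩
      ε                ∎

module Modular where

  open import Data.Nat as ℕ using (ℕ; zero; suc; _<_; _≟_)
  import Data.Nat.Properties as ℕ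
  open import Data.Nat.Divisibility as ℕ∣ using () renaming (_∣_ to _∣ℕ_)
  open import Data.Nat.Primality using (Prime; prime⇒nonZero; euclidsLemma; ¬prime[1])
  open import Data.Nat.Coprimality using (prime⇒coprime; coprime-Bézout)
  open import Data.Nat.GCD using (module Bézout)
  open import Data.Integer as ℤ using (ℤ; +_; 0ℤ; 1ℤ; -1ℤ; _+_; _-_; _*_; -_)
  import Data.Integer.Properties as ℤ
  open import Data.Integer.Divisibility.Signed
  open import Data.Integer.DivMod using (_%ℕ_; _/ℕ_; n%ℕd<d; a≡a%ℕn+[a/ℕn]*n)
  open import Data.Integer.Tactic.RingSolver using (solve-∀)
  open import Data.Product using (Σ; _×_; _,_; proj₁; proj₂)
  open import Data.Sum as Sum using (_⊎_; [_,_]′)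
  open import Function using (_∘_; flip; id)
  open import Relation.Binary.Bundles using (Setoid)
  open import Relation.Binary.Structures using (IsEquivalence)
  open import Relation.Binary.PropositionalEquality as ≡ using (_≡_; _≢_; cong; cong₂; subst)
  open import Relation.Nullary using (Dec; yes; no; ¬_; contradiction)

  infix 4 _≡_mod_
  record _≡_mod_ (x y : ℤ) (m : ℕ) : Set where
    constructor congruent
    field divides-difference : + m ∣ x - y
  open _≡_mod_ public

  module Congruence (m : ℕ) where

    private
      variable
        x y z u v : ℤ

    reflexive : x ≡ y → x ≡ y mod m
    reflexive {x} ≡.refl = congruent (divides 0ℤ (ℤ.+-inverseʳ x))

    refl : x ≡ x mod m
    refl = reflexive ≡.refl

    sym : x ≡ y mod m → y ≡ x mod m
    sym {x} {y} (congruent m∣x-y) = congruent (subst (+ m ∣_) (lemma x y) (∣m⇒∣-m m∣x-y))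
      where
      lemma : ∀ x y → - (x - y) ≡ y - x
      lemma = solve-∀

    trans : x ≡ y mod m → y ≡ z mod m → x ≡ z mod m
    trans {x} {y} {z} (congruent m∣x-y) (congruent m∣y-z) =
      congruent (subst (+ m ∣_) (lemma x y z) (∣m∣n⇒∣m+n m∣x-y m∣y-z))
      where
      lemma : ∀ x y z → (x - y) + (y - z) ≡ x - z
      lemma = solve-∀

    +-cong : x ≡ y mod m → u ≡ v mod m → x + u ≡ y + v mod m
    +-cong {x} {y} {u} {v} (congruent m∣x-y) (congruent m∣u-v) =
      congruent (subst (+ m ∣_) (lemma x y u v) (∣m∣n⇒∣m+n m∣x-y m∣u-v))
      where
      lemma : ∀ x y u v → (x - y) + (u - v) ≡ (x + u) - (y + v)
      lemma = solve-∀

    *-cong : x ≡ y mod m → u ≡ v mod m → x * u ≡ y * v mod m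
    *-cong {x} {y} {u} {v} (congruent m∣x-y) (congruent m∣u-v) =
      congruent (subst (+ m ∣_) (lemma x y u v) (∣m∣n⇒∣m+n (∣m⇒∣m*n u m∣x-y) (∣n⇒∣m*n y m∣u-v)))
      where
      lemma : ∀ x y u v → (x - y) * u + y * (u - v) ≡ x * u - y * v
      lemma = solve-∀

    ∣⇒≡0 : + m ∣ x → x ≡ 0ℤ mod m
    ∣⇒≡0 {x} m∣x = congruent (subst (+ m ∣_) (≡.sym (ℤ.+-identityʳ x)) m∣x)

    ≡0⇒∣ : x ≡ 0ℤ mod m → + m ∣ x
    ≡0⇒∣ {x} (congruent m∣x-0) = subst (+ m ∣_) (ℤ.+-identityʳ x) m∣x-0

    multiple+≡ : ∀ a b → m ∣ℕ a → + (a ℕ.+ b) ≡ + b mod m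
    multiple+≡ a b m∣a =
      trans (reflexive (ℤ.pos-+ a b)) (+-cong (∣⇒≡0 (∣ᵤ⇒∣ {+ m} {+ a} m∣a)) (refl {+ b}))

    isEquivalence : IsEquivalence (λ x y → x ≡ y mod m)
    isEquivalence = record { refl = refl ; sym = sym ; trans = trans }

    setoid : Setoid _ _
    setoid = record { isEquivalence = isEquivalence }

    inverse-unique : x * y ≡ 1ℤ mod m → y * z ≡ 1ℤ mod m → z ≡ x mod m
    inverse-unique {x} {y} {z} xy≡1 yz≡1 = begin
      z             ≡⟨ ℤ.*-identityˡ z ⟨
      1ℤ * z        ≈⟨ *-cong xy≡1 (refl {z}) ⟨
      (x * y) * z   ≡⟨ ℤ.*-assoc x y z ⟩
      x * (y * z)   ≈⟨ *-cong (refl {x}) yz≡1 ⟩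
      x * 1ℤ        ≡⟨ ℤ.*-identityʳ x ⟩
      x             ∎
      where open import Relation.Binary.Reasoning.Setoid setoid

    *-1-commutativeMonoid : CommutativeMonoid _ _
    *-1-commutativeMonoid = record
      { Carrier = ℤ
      ; _≈_ = λ x y → x ≡ y mod m
      ; _∙_ = _*_
      ; ε = 1ℤ
      ; isCommutativeMonoid = record
        { isMonoid = record
          { isSemigroup = record
            { isMagma = record { isEquivalence = isEquivalence ; ∙-cong = *-cong }
            ; assoc = λ x y z → reflexive (ℤ.*-assoc x y z)
            }
          ; identity = (λ x → reflexive (ℤ.*-identityˡ x)) , (λ x → reflexive (ℤ.*-identityʳ x))
          }
        ; comm = λ x y → reflexive (ℤ.*-comm x y)
        }
      }

  module _ {p : ℕ} (p-prime : Prime p) where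

    open Congruence p
    open Product *-1-commutativeMonoid using (∏<; ∏<-exchange; ∏<-involution)
    import Relation.Binary.Reasoning.Setoid setoid as ≋-Reasoning

    private
      instance
        p≢0 : ℕ.NonZero p
        p≢0 = prime⇒nonZero p-prime

    %ℕ-congruent : ∀ x → + (x %ℕ p) ≡ x mod p
    %ℕ-congruent x = congruent (divides (- (x /ℕ p))
      (≡.trans (cong (λ y → + (x %ℕ p) - y) (a≡a%ℕn+[a/ℕn]*n x p)) (lemma (+ (x %ℕ p)) (x /ℕ p) (+ p))))
      where
      lemma : ∀ r q m → r - (r + q * m) ≡ - q * m
      lemma = solve-∀

    ≡mod⇒≡ : ∀ {i j} → i < p → j < p → + i ≡ + j mod p → i ≡ j
    ≡mod⇒≡ {i} {j} i<p j<p (congruent p∣i-j) =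
      ℤ.+-injective (ℤ.i-j≡0⇒i≡j (+ i) (+ j)
        (≡.trans (ℤ.[+m]-[+n]≡m⊖n i j) (ℤ.∣i∣≡0⇒i≡0 (small (ℤ.∣ i ℤ.⊖ j ∣) p∣i⊖j ∣i⊖j∣<p))))
      where
      small : ∀ d → p ∣ℕ d → d < p → d ≡ 0
      small zero _ _ = ≡.refl
      small (suc d) p∣d d<p = contradiction p∣d (ℕ∣.>⇒∤ d<p)
      p∣i⊖j : p ∣ℕ ℤ.∣ i ℤ.⊖ j ∣
      p∣i⊖j = subst (λ d → p ∣ℕ ℤ.∣ d ∣) (ℤ.[+m]-[+n]≡m⊖n i j) (∣⇒∣ᵤ p∣i-j)
      ∣i⊖j∣<p : ℤ.∣ i ℤ.⊖ j ∣ < p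
      ∣i⊖j∣<p = ℕ.≤-<-trans (ℤ.∣m⊝n∣≤m⊔n i j) (ℕ.⊔-lub i<p j<p)

    euclidsLemmaℤ : ∀ x y → + p ∣ x * y → + p ∣ x ⊎ + p ∣ y
    euclidsLemmaℤ x y p∣xy = Sum.map ∣ᵤ⇒∣ ∣ᵤ⇒∣
      (euclidsLemma ℤ.∣ x ∣ ℤ.∣ y ∣ p-prime (subst (p ∣ℕ_) (ℤ.abs-* x y) (∣⇒∣ᵤ p∣xy)))

    p∤1 : ¬ (+ p ∣ 1ℤ)
    p∤1 p∣1 = ¬prime[1] (subst Prime (ℕ∣.∣1⇒≡1 (∣⇒∣ᵤ p∣1)) p-prime)

    p∤2^ : 2 < p → ∀ n → ¬ (p ∣ℕ 2 ℕ.^ n)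
    p∤2^ 2<p zero p∣1 = p∤1 (∣ᵤ⇒∣ p∣1)
    p∤2^ 2<p (suc n) p∣2*2^n = [ ℕ∣.>⇒∤ 2<p , p∤2^ 2<p n ]′ (euclidsLemma 2 (2 ℕ.^ n) p-prime p∣2*2^n)

    *-cancelˡ : ∀ {c x y} → ¬ (+ p ∣ c) → c * x ≡ c * y mod p → x ≡ y mod p
    *-cancelˡ {c} {x} {y} p∤c (congruent p∣cx-cy) =
      [ flip contradiction p∤c , congruent ]′
        (euclidsLemmaℤ c (x - y) (subst (+ p ∣_) (lemma c x y) p∣cx-cy))
      where
      lemma : ∀ c x y → c * x - c * y ≡ c * (x - y)
      lemma = solve-∀

    x²≡1⇒x≡±1 : ∀ x → x * x ≡ 1ℤ mod p → x ≡ 1ℤ mod p ⊎ x ≡ -1ℤ mod p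
    x²≡1⇒x≡±1 x (congruent p∣x²-1) =
      Sum.map congruent congruent (euclidsLemmaℤ (x - 1ℤ) (x - -1ℤ) (subst (+ p ∣_) (lemma x) p∣x²-1))
      where
      lemma : ∀ x → x * x - 1ℤ ≡ (x - 1ℤ) * (x - -1ℤ)
      lemma = solve-∀

    unit⇒∤ : ∀ {x y} → x * y ≡ 1ℤ mod p → ¬ (+ p ∣ x)
    unit⇒∤ {x} {y} (congruent p∣xy-1) p∣x =
      p∤1 (subst (+ p ∣_) (lemma x y) (∣m∣n⇒∣m-n (∣m⇒∣m*n y p∣x) p∣xy-1))
      where
      lemma : ∀ x y → x * y - (x * y - 1ℤ) ≡ 1ℤ
      lemma = solve-∀

    inverse-residue : ∀ r → suc r < p → Σ ℤ λ y → + suc r * y ≡ 1ℤ mod p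
    inverse-residue r r<p with coprime-Bézout (prime⇒coprime p-prime r<p)
    ... | Bézout.+- s t eq = - + t , congruent (divides (- + s) (begin
      + suc r * - + t - 1ℤ    ≡⟨ lemma (+ suc r) (+ t) ⟩
      - (1ℤ + + t * + suc r)  ≡⟨ cong (λ z → - (1ℤ + z)) (ℤ.pos-* t (suc r)) ⟨
      - + (1 ℕ.+ t ℕ.* suc r) ≡⟨ cong (λ z → - + z) eq ⟩
      - + (s ℕ.* p)           ≡⟨ cong -_ (ℤ.pos-* s p) ⟩
      - (+ s * + p)           ≡⟨ ℤ.neg-distribˡ-* (+ s) (+ p) ⟩
      - + s * + p             ∎))
      where
      open ≡.≡-Reasoning
      lemma : ∀ r t → r * - t - 1ℤ ≡ - (1ℤ + t * r)
      lemma = solve-∀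
    ... | Bézout.-+ s t eq = + t , (begin
      + suc r * + t      ≡⟨ ℤ.pos-* (suc r) t ⟨
      + (suc r ℕ.* t)
        ≡⟨ cong +_ (≡.trans (ℕ.*-comm (suc r) t) (≡.trans (≡.sym eq) (ℕ.+-comm 1 (s ℕ.* p)))) ⟩
      + (s ℕ.* p ℕ.+ 1)  ≈⟨ multiple+≡ (s ℕ.* p) 1 (ℕ∣.∣n⇒∣m*n s ℕ∣.∣-refl) ⟩
      1ℤ                 ∎)
      where open ≋-Reasoning

    inverse : ∀ x → ¬ (+ p ∣ x) → Σ ℤ λ y → x * y ≡ 1ℤ mod p
    inverse x p∤x = via-residue (x %ℕ p) (%ℕ-congruent x) (n%ℕd<d x p)
      where
      via-residue : ∀ r → + r ≡ x mod p → r < p → Σ ℤ λ y → x * y ≡ 1ℤ mod p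
      via-residue zero 0≡x _ = contradiction (≡0⇒∣ (sym 0≡x)) p∤x
      via-residue (suc r) r≡x r<p = proj₁ (inverse-residue r r<p) ,
        trans (*-cong (sym r≡x) refl) (proj₂ (inverse-residue r r<p))

    module Progression (a b : ℤ) (p∤a : ¬ (+ p ∣ a)) where

      term : ℕ → ℤ
      term i = a * + i + b

      solve : ∀ c → Σ ℕ λ j → j < p × term j ≡ c mod p
      solve c = j , n%ℕd<d ((c - b) * a⁻¹) p , (begin
        a * + j + b               ≈⟨ +-cong (*-cong (refl {a}) (%ℕ-congruent ((c - b) * a⁻¹))) (refl {b}) ⟩
        a * ((c - b) * a⁻¹) + b   ≡⟨ lemma₁ a (c - b) a⁻¹ b ⟩
        (a * a⁻¹) * (c - b) + b   ≈⟨ +-cong (*-cong (proj₂ (inverse a p∤a)) (refl {c - b})) (refl {b}) ⟩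
        1ℤ * (c - b) + b          ≡⟨ lemma₂ c b ⟩
        c                         ∎)
        where
        open ≋-Reasoning
        a⁻¹ = proj₁ (inverse a p∤a)
        j = ((c - b) * a⁻¹) %ℕ p
        lemma₁ : ∀ a d a⁻¹ b → a * (d * a⁻¹) + b ≡ (a * a⁻¹) * d + b
        lemma₁ = solve-∀
        lemma₂ : ∀ c b → 1ℤ * (c - b) + b ≡ c
        lemma₂ = solve-∀

      term-injective : ∀ {i j} → i < p → j < p → term i ≡ term j mod p → i ≡ j
      term-injective {i} {j} i<p j<p (congruent p∣ti-tj) =
        [ flip contradiction p∤a , ≡mod⇒≡ i<p j<p ∘ congruent ]′
          (euclidsLemmaℤ a (+ i - + j) (subst (+ p ∣_) (lemma a (+ i) (+ j) b) p∣ti-tj))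
        where
        lemma : ∀ a i j b → (a * i + b) - (a * j + b) ≡ a * (i - j)
        lemma = solve-∀

      termExcept : ℕ → ℕ → ℤ
      termExcept z i with i ≟ z
      ... | yes _ = 1ℤ
      ... | no _ = term i

      termExcept-self : ∀ z → termExcept z z ≡ 1ℤ
      termExcept-self z with z ≟ z
      ... | yes _ = ≡.refl
      ... | no z≢z = contradiction ≡.refl z≢z

      termExcept-other : ∀ {z i} → i ≢ z → termExcept z i ≡ term i
      termExcept-other {z} {i} i≢z with i ≟ z
      ... | yes i≡z = contradiction i≡z i≢z
      ... | no _ = ≡.refl

      -- Wilson's theorem for the progression a i + b: pairing each nonzero term with the
      -- term congruent to its inverse leaves unpaired only the terms ≡ 1 and ≡ -1.
      module _ {z : ℕ} (z<p : z < p) (tz≡0 : term z ≡ 0ℤ mod p) where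

        private
          ∣term⇒≡z : ∀ {i} → i < p → + p ∣ term i → i ≡ z
          ∣term⇒≡z i<p p∣ti = term-injective i<p z<p (trans (∣⇒≡0 p∣ti) (sym tz≡0))

          partner : ℕ → ℕ
          partner i with + p ∣? term i
          ... | yes _ = i
          ... | no p∤ti = proj₁ (solve (proj₁ (inverse (term i) p∤ti)))

          partner-fixed : ∀ {i} → + p ∣ term i → partner i ≡ i
          partner-fixed {i} p∣ti with + p ∣? term i
          ... | yes _ = ≡.refl
          ... | no p∤ti = contradiction p∣ti p∤ti

          partner-< : ∀ {i} → i < p → partner i < p
          partner-< {i} i<p with + p ∣? term i
          ... | yes _ = i<p
          ... | no p∤ti = proj₁ (proj₂ (solve (proj₁ (inverse (term i) p∤ti))))

          partner-inverse : ∀ {i} → ¬ (+ p ∣ term i) → term i * term (partner i) ≡ 1ℤ mod p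
          partner-inverse {i} p∤ti with + p ∣? term i
          ... | yes p∣ti = contradiction p∣ti p∤ti
          ... | no p∤ti = trans (*-cong (refl {term i}) (proj₂ (proj₂ (solve ti⁻¹)))) (proj₂ (inverse (term i) p∤ti))
            where ti⁻¹ = proj₁ (inverse (term i) p∤ti)

          partner-unique : ∀ {i j} → i < p → j < p → term i * term j ≡ 1ℤ mod p → partner i ≡ j
          partner-unique {i} {j} i<p j<p titj≡1 = term-injective (partner-< i<p) j<p
            (inverse-unique (trans (reflexive (ℤ.*-comm (term j) (term i))) titj≡1)
                            (partner-inverse (unit⇒∤ titj≡1)))

          partner-involutive : ∀ {i} → i < p → partner (partner i) ≡ i
          partner-involutive {i} i<p = by-cases (+ p ∣? term i)
            where
            by-cases : Dec (+ p ∣ term i) → partner (partner i) ≡ i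
            by-cases (yes p∣ti) = ≡.trans (cong partner (partner-fixed p∣ti)) (partner-fixed p∣ti)
            by-cases (no p∤ti) = partner-unique (partner-< i<p) i<p
              (trans (reflexive (ℤ.*-comm (term (partner i)) (term i))) (partner-inverse p∤ti))

          module _ {k : ℕ} (k<p : k < p) (tk≡-1 : term k ≡ -1ℤ mod p) where

            k≢z : k ≢ z
            k≢z ≡.refl = p∤1 (∣m⇒∣-m (divides-difference (trans (sym tk≡-1) tz≡0)))

            partner-k : partner k ≡ k
            partner-k = partner-unique k<p k<p (*-cong tk≡-1 tk≡-1)

            paired-term : ℕ → ℤ
            paired-term i with i ≟ k
            ... | yes _ = 1ℤ
            ... | no _ = termExcept z i

            paired-term-k : paired-term k ≡ 1ℤ
            paired-term-k with k ≟ k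
            ... | yes _ = ≡.refl
            ... | no k≢k = contradiction ≡.refl k≢k

            paired-term-other : ∀ {i} → i ≢ k → paired-term i ≡ termExcept z i
            paired-term-other {i} i≢k with i ≟ k
            ... | yes i≡k = contradiction i≡k i≢k
            ... | no _ = ≡.refl

            paired-term-fixed : ∀ {i} → i < p → partner i ≡ i → paired-term i ≡ 1ℤ mod p
            paired-term-fixed {i} i<p fi≡i with i ≟ k
            ... | yes _ = refl
            ... | no i≢k with i ≟ z
            ...   | yes _ = refl
            ...   | no i≢z =
              [ id , (λ ti≡-1 → contradiction (term-injective i<p k<p (trans ti≡-1 (sym tk≡-1))) i≢k) ]′
                (x²≡1⇒x≡±1 (term i) (subst (λ j → term i * term j ≡ 1ℤ mod p) fi≡i (partner-inverse p∤ti)))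
              where
              p∤ti : ¬ (+ p ∣ term i)
              p∤ti p∣ti = i≢z (∣term⇒≡z i<p p∣ti)

            paired-term-paired : ∀ {i} → i < p → partner i ≢ i →
                                 paired-term i * paired-term (partner i) ≡ 1ℤ mod p
            paired-term-paired {i} i<p fi≢i =
              subst (_≡ 1ℤ mod p) (≡.sym (cong₂ _*_ (as-term i≢z i≢k) (as-term j≢z j≢k))) titj≡1
              where
              j = partner i
              p∤ti : ¬ (+ p ∣ term i)
              p∤ti p∣ti = fi≢i (partner-fixed p∣ti)
              titj≡1 : term i * term j ≡ 1ℤ mod p
              titj≡1 = partner-inverse p∤ti
              as-term : ∀ {l} → l ≢ z → l ≢ k → paired-term l ≡ term l
              as-term l≢z l≢k = ≡.trans (paired-term-other l≢k) (termExcept-other l≢z)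
              i≢z : i ≢ z
              i≢z i≡z = p∤ti (subst (λ l → + p ∣ term l) (≡.sym i≡z) (≡0⇒∣ tz≡0))
              i≢k : i ≢ k
              i≢k i≡k = fi≢i (≡.trans (cong partner i≡k) (≡.trans partner-k (≡.sym i≡k)))
              j≢z : j ≢ z
              j≢z j≡z = unit⇒∤ (trans (reflexive (ℤ.*-comm (term j) (term i))) titj≡1)
                               (subst (λ l → + p ∣ term l) (≡.sym j≡z) (≡0⇒∣ tz≡0))
              j≢k : j ≢ k
              j≢k j≡k = i≢k (≡.trans (≡.sym (partner-involutive i<p))
                                     (≡.trans (cong partner j≡k) partner-k))

            ∏<-termExcept : ∏< p (termExcept z) ≡ -1ℤ mod p
            ∏<-termExcept = begin
              ∏< p (termExcept z)                ≡⟨ ℤ.*-identityʳ _ ⟨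
              ∏< p (termExcept z) * 1ℤ           ≡⟨ cong (∏< p (termExcept z) *_) paired-term-k ⟨
              ∏< p (termExcept z) * paired-term k
                ≈⟨ ∏<-exchange p k<p (λ i<p i≢k → reflexive (≡.sym (paired-term-other i≢k))) ⟩
              termExcept z k * ∏< p paired-term
                ≈⟨ *-cong (trans (reflexive (termExcept-other k≢z)) tk≡-1)
                          (∏<-involution partner-< partner-involutive paired-term-fixed paired-term-paired) ⟩
              -1ℤ * 1ℤ                           ≡⟨⟩
              -1ℤ                                ∎
              where open ≋-Reasoning

        wilson : ∏< p (termExcept z) ≡ -1ℤ mod p
        wilson = let (_ , k<p , tk≡-1) = solve -1ℤ in ∏<-termExcept k<p tk≡-1

module TripleFactorial where

  open import Defs
  open import Data.Nat as ℕ
  open import Data.Nat.Properties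
  open import Data.Nat.Divisibility using (_∣_; _∣0; ∣-refl; ∣m⇒∣m*n; ∣n⇒∣m*n; ∣m∣n⇒∣m+n)
  open import Data.Nat.Tactic.RingSolver using (solve-∀)
  open import Data.Sum using (inj₁; inj₂)
  open import Relation.Binary.PropositionalEquality
  open import Relation.Nullary using (Dec; yes; no; ¬_; contradiction)

  T : ℕ → ℕ → ℕ
  T c m = tf (3 * m + c)

  T-suc : ∀ c m → T c (suc m) ≡ (3 * suc m + c) * T c m
  T-suc c m = trans (cong tf (3[1+m]+c≡3+3m+c m c)) (cong (_* T c m) (sym (3[1+m]+c≡3+3m+c m c)))
    where
    3[1+m]+c≡3+3m+c : ∀ m c → 3 * suc m + c ≡ 3 + (3 * m + c)
    3[1+m]+c≡3+3m+c = solve-∀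

  -- tfRatio c j m = T c m / T c j when j ≤ m (and 1 otherwise).
  tfRatio : ℕ → ℕ → ℕ → ℕ
  tfRatio c j zero = 1
  tfRatio c j (suc m) with j ≤? m
  ... | yes _ = (3 * suc m + c) * tfRatio c j m
  ... | no _ = 1

  tfRatio-suc : ∀ c {j m} → j ≤ m → tfRatio c j (suc m) ≡ (3 * suc m + c) * tfRatio c j m
  tfRatio-suc c {j} {m} j≤m with j ≤? m
  ... | yes _ = refl
  ... | no j≰m = contradiction j≤m j≰m

  tfRatio-stop : ∀ c {j m} → ¬ j ≤ m → tfRatio c j (suc m) ≡ 1
  tfRatio-stop c {j} {m} j≰m with j ≤? m
  ... | yes j≤m = contradiction j≤m j≰m
  ... | no _ = refl

  tfRatio-self : ∀ c j → tfRatio c j j ≡ 1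
  tfRatio-self c zero = refl
  tfRatio-self c (suc j) = tfRatio-stop c (n≮n j)

  T≡tfRatio*T : ∀ c {j m} → j ≤ m → T c m ≡ tfRatio c j m * T c j
  T≡tfRatio*T c {j} {m} j≤m with m≤n⇒m<n∨m≡n j≤m
  ... | inj₂ refl = sym (trans (cong (_* T c j) (tfRatio-self c j)) (*-identityˡ (T c j)))
  T≡tfRatio*T c {j} {suc m} _ | inj₁ (s≤s j≤m) = begin
    T c (suc m)                               ≡⟨ T-suc c m ⟩
    (3 * suc m + c) * T c m                   ≡⟨ cong ((3 * suc m + c) *_) (T≡tfRatio*T c j≤m) ⟩
    (3 * suc m + c) * (tfRatio c j m * T c j) ≡⟨ *-assoc (3 * suc m + c) (tfRatio c j m) (T c j) ⟨
    (3 * suc m + c) * tfRatio c j m * T c j   ≡⟨ cong (_* T c j) (tfRatio-suc c j≤m) ⟨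
    tfRatio c j (suc m) * T c j               ∎
    where open ≡-Reasoning

  tfRatio-shift : ∀ c j m → tfRatio c (suc j) (suc m) ≡ tfRatio (3 + c) j m
  tfRatio-shift c j zero = refl
  tfRatio-shift c j (suc m) = by-cases (j ≤? m)
    where
    3[2+m]+c≡3[1+m]+[3+c] : ∀ m c → 3 * suc (suc m) + c ≡ 3 * suc m + (3 + c)
    3[2+m]+c≡3[1+m]+[3+c] = solve-∀
    by-cases : Dec (j ≤ m) → tfRatio c (suc j) (suc (suc m)) ≡ tfRatio (3 + c) j (suc m)
    by-cases (yes j≤m) = begin
      tfRatio c (suc j) (suc (suc m))                   ≡⟨ tfRatio-suc c (s≤s j≤m) ⟩
      (3 * suc (suc m) + c) * tfRatio c (suc j) (suc m)
        ≡⟨ cong₂ _*_ (3[2+m]+c≡3[1+m]+[3+c] m c) (tfRatio-shift c j m) ⟩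
      (3 * suc m + (3 + c)) * tfRatio (3 + c) j m       ≡⟨ tfRatio-suc (3 + c) j≤m ⟨
      tfRatio (3 + c) j (suc m)                         ∎
      where open ≡-Reasoning
    by-cases (no j≰m) =
      trans (tfRatio-stop c (λ 1+j≤1+m → j≰m (s≤s⁻¹ 1+j≤1+m))) (sym (tfRatio-stop (3 + c) j≰m))

  factor∣tfRatio : ∀ c {i j m} → j < i → i ≤ m → 3 * i + c ∣ tfRatio c j m
  factor∣tfRatio c {m = zero} () z≤n
  factor∣tfRatio c {i} {j} {suc m} j<i i≤1+m with m≤n⇒m<n∨m≡n i≤1+m
  ... | inj₁ (s≤s i≤m) = subst (3 * i + c ∣_) (sym (tfRatio-suc c (<⇒≤ (<-≤-trans j<i i≤m))))
                                (∣n⇒∣m*n (3 * suc m + c) (factor∣tfRatio c j<i i≤m))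
  ... | inj₂ refl =
    subst (3 * i + c ∣_) (sym (tfRatio-suc c (s≤s⁻¹ j<i))) (∣m⇒∣m*n (tfRatio c j m) ∣-refl)

  factor∣T : ∀ c {i m} → suc i ≤ m → 3 * suc i + c ∣ T c m
  factor∣T c {i} {m} i<m =
    subst (3 * suc i + c ∣_) (sym (trans (T≡tfRatio*T c i<m) (cong (tfRatio c (suc i) m *_) (T-suc c i))))
          (∣n⇒∣m*n (tfRatio c (suc i) m) (∣m⇒∣m*n (T c i) ∣-refl))

  suc∣T₃ : ∀ n → suc n ∣ T 3 n
  suc∣T₃ n = subst (suc n ∣_) (sym T₃≡[1+n]*3*tf) (∣m⇒∣m*n (tf (3 * n)) (∣m⇒∣m*n 3 ∣-refl))
    where
    [1+n]*3≡3+3n : ∀ n → suc n * 3 ≡ 3 + 3 * n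
    [1+n]*3≡3+3n = solve-∀
    T₃≡[1+n]*3*tf : T 3 n ≡ suc n * 3 * tf (3 * n)
    T₃≡[1+n]*3*tf = trans (cong tf (+-comm (3 * n) 3)) (cong (_* tf (3 * n)) (sym ([1+n]*3≡3+3n n)))

  sumFrom : ℕ → ℕ → (ℕ → ℕ) → ℕ
  sumFrom i zero g = 0
  sumFrom i (suc n) g = g i + sumFrom (suc i) n g

  range-tail : ∀ {i n} {P : ℕ → Set} → (∀ {j} → i ≤ j → j < i + suc n → P j) →
               ∀ {j} → suc i ≤ j → j < suc i + n → P j
  range-tail {i} {n} h {j} i<j j<1+i+n = h (<⇒≤ i<j) (subst (j <_) (sym (+-suc i n)) j<1+i+n)

  sumFrom-snoc : ∀ i n g → sumFrom i (suc n) g ≡ sumFrom i n g + g (i + n)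
  sumFrom-snoc i zero g = trans (+-identityʳ (g i)) (cong g (sym (+-identityʳ i)))
  sumFrom-snoc i (suc n) g = begin
    g i + sumFrom (suc i) (suc n) g             ≡⟨ cong (g i +_) (sumFrom-snoc (suc i) n g) ⟩
    g i + (sumFrom (suc i) n g + g (suc i + n)) ≡⟨ +-assoc (g i) _ _ ⟨
    g i + sumFrom (suc i) n g + g (suc i + n)   ≡⟨ cong (λ k → g i + sumFrom (suc i) n g + g k) (+-suc i n) ⟨
    g i + sumFrom (suc i) n g + g (i + suc n)   ∎
    where open ≡-Reasoning

  sumFrom-cong : ∀ i n {g h} → (∀ {j} → i ≤ j → j < i + n → g j ≡ h j) → sumFrom i n g ≡ sumFrom i n h
  sumFrom-cong i zero eq = refl
  sumFrom-cong i (suc n) eq = cong₂ _+_ (eq ≤-refl (m<m+n i z<s)) (sumFrom-cong (suc i) n (range-tail eq))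

  sumFrom-*ˡ : ∀ i n c g → sumFrom i n (λ j → c * g j) ≡ c * sumFrom i n g
  sumFrom-*ˡ i zero c g = sym (*-zeroʳ c)
  sumFrom-*ˡ i (suc n) c g =
    trans (cong (c * g i +_) (sumFrom-*ˡ (suc i) n c g)) (sym (*-distribˡ-+ c (g i) _))

  ∣-sumFrom : ∀ {d} i n {g} → (∀ {j} → i ≤ j → j < i + n → d ∣ g j) → d ∣ sumFrom i n g
  ∣-sumFrom {d} i zero _ = d ∣0
  ∣-sumFrom i (suc n) d∣g = ∣m∣n⇒∣m+n (d∣g ≤-refl (m<m+n i z<s)) (∣-sumFrom (suc i) n (range-tail d∣g))

  weightedSum : ℕ → (ℕ → ℕ) → ℕ → ℕ
  weightedSum c h m = sumFrom 1 m (λ j → tfRatio c j m * h j)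

  weightedSum-shift : ∀ c h m →
    sumFrom 1 m (λ j → tfRatio c j (suc m) * h j) ≡ (3 * suc m + c) * weightedSum c h m
  weightedSum-shift c h m =
    trans (sumFrom-cong 1 m step) (sumFrom-*ˡ 1 m (3 * suc m + c) (λ j → tfRatio c j m * h j))
    where
    step : ∀ {j} → 1 ≤ j → j < 1 + m → tfRatio c j (suc m) * h j ≡ (3 * suc m + c) * (tfRatio c j m * h j)
    step {j} _ j<1+m = trans (cong (_* h j) (tfRatio-suc c (s≤s⁻¹ j<1+m))) (*-assoc (3 * suc m + c) (tfRatio c j m) (h j))

  weightedSum-suc : ∀ c h m → weightedSum c h (suc m) ≡ (3 * suc m + c) * weightedSum c h m + h (suc m)
  weightedSum-suc c h m = begin
    weightedSum c h (suc m)                                      ≡⟨ sumFrom-snoc 1 m _ ⟩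
    sumFrom 1 m (λ j → tfRatio c j (suc m) * h j) + tfRatio c (suc m) (suc m) * h (suc m)
      ≡⟨ cong₂ _+_ (weightedSum-shift c h m) (cong (_* h (suc m)) (tfRatio-self c (suc m))) ⟩
    (3 * suc m + c) * weightedSum c h m + 1 * h (suc m)
      ≡⟨ cong ((3 * suc m + c) * weightedSum c h m +_) (*-identityˡ (h (suc m))) ⟩
    (3 * suc m + c) * weightedSum c h m + h (suc m)              ∎
    where open ≡-Reasoning

module ClosedForms where

  open import Data.Nat as ℕ
  open import Data.Nat.Properties
  open import Data.Nat.Tactic.RingSolver using (solve-∀)
  open import Relation.Binary.PropositionalEquality
  open ≡-Reasoning
  open TripleFactorial

  private
    cong₃ : ∀ (f : ℕ → ℕ → ℕ → ℕ) {x x′ y y′ z z′} → x ≡ x′ → y ≡ y′ → z ≡ z′ →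
            f x y z ≡ f x′ y′ z′
    cong₃ f refl refl refl = refl

  innerℕ : ℕ → ℕ
  innerℕ n = T 2 n + sumFrom 1 (n ∸ 1) (λ j → tfRatio 2 j n * T 1 j)

  middleℕ : ℕ → ℕ
  middleℕ r = sumFrom 1 (r ∸ 1) (λ n → tfRatio 3 n r * innerℕ n)

  βℕ : ℕ → ℕ
  βℕ p = sumFrom 1 (p ∸ 1) (λ r → tfRatio 1 (suc r) p * middleℕ r)

  S₁ S₂ S₃ G : ℕ → ℕ
  S₁ = weightedSum 2 (T 1)
  S₂ = weightedSum 3 innerℕ
  S₃ = weightedSum 4 middleℕ
  G = weightedSum 4 (T 1)

  innerℕ-suc : ∀ m → innerℕ (suc m) ≡ (3 * suc m + 2) * T 2 m + (3 * suc m + 2) * S₁ m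
  innerℕ-suc m = cong₂ _+_ (T-suc 2 m) (weightedSum-shift 2 (T 1) m)

  middleℕ-suc : ∀ m → middleℕ (suc m) ≡ (3 * suc m + 3) * S₂ m
  middleℕ-suc = weightedSum-shift 3 innerℕ

  βℕ-suc : ∀ n → βℕ (suc n) ≡ S₃ n
  βℕ-suc n = sumFrom-cong 1 n (λ {r} _ _ → cong (_* middleℕ r) (tfRatio-shift 1 r n))

  S₁-closed : ∀ m → 2 * S₁ m + 4 * T 2 m ≡ (3 * m + 4) * T 1 m
  S₁-closed zero = refl
  S₁-closed (suc m) = begin
    2 * S₁ (suc m) + 4 * T 2 (suc m)
      ≡⟨ cong₂ (λ s t → 2 * s + 4 * t) (weightedSum-suc 2 (T 1) m) (T-suc 2 m) ⟩
    2 * ((3 * suc m + 2) * S₁ m + T 1 (suc m)) + 4 * ((3 * suc m + 2) * T 2 m)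
      ≡⟨ cong (λ t → 2 * ((3 * suc m + 2) * S₁ m + t) + 4 * ((3 * suc m + 2) * T 2 m)) (T-suc 1 m) ⟩
    2 * ((3 * suc m + 2) * S₁ m + (3 * suc m + 1) * T 1 m) + 4 * ((3 * suc m + 2) * T 2 m)
      ≡⟨ regroup m (S₁ m) (T 1 m) (T 2 m) ⟩
    (3 * m + 5) * (2 * S₁ m + 4 * T 2 m) + 2 * ((3 * m + 4) * T 1 m)
      ≡⟨ cong (λ e → (3 * m + 5) * e + 2 * ((3 * m + 4) * T 1 m)) (S₁-closed m) ⟩
    (3 * m + 5) * ((3 * m + 4) * T 1 m) + 2 * ((3 * m + 4) * T 1 m)
      ≡⟨ collect m (T 1 m) ⟩
    (3 * suc m + 4) * ((3 * suc m + 1) * T 1 m)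
      ≡⟨ cong ((3 * suc m + 4) *_) (T-suc 1 m) ⟨
    (3 * suc m + 4) * T 1 (suc m) ∎
    where
    regroup : ∀ m s t₁ t₂ → 2 * ((3 * suc m + 2) * s + (3 * suc m + 1) * t₁) + 4 * ((3 * suc m + 2) * t₂)
                            ≡ (3 * m + 5) * (2 * s + 4 * t₂) + 2 * ((3 * m + 4) * t₁)
    regroup = solve-∀
    collect : ∀ m t₁ →
      (3 * m + 5) * ((3 * m + 4) * t₁) + 2 * ((3 * m + 4) * t₁) ≡ (3 * suc m + 4) * ((3 * suc m + 1) * t₁)
    collect = solve-∀

  -- Both sides are padded with 8 T₁(m) in the inductive step, to avoid subtraction.
  S₂-closed : ∀ m → 8 * S₂ m + 4 * T 1 m + (12 * m + 20) * T 2 m ≡ (9 * m * m + 9 * m) * T 1 m + 8 * T 3 m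
  S₂-closed zero = refl
  S₂-closed (suc m) = +-cancelʳ-≡ (8 * T 1 m) _ _ (begin
    8 * S₂ (suc m) + 4 * T 1 (suc m) + (12 * suc m + 20) * T 2 (suc m) + 8 * T 1 m
      ≡⟨ cong₃ (λ s t₁ t₂ → 8 * s + 4 * t₁ + (12 * suc m + 20) * t₂ + 8 * T 1 m)
               (trans (weightedSum-suc 3 innerℕ m) (cong ((3 * suc m + 3) * S₂ m +_) (innerℕ-suc m)))
               (T-suc 1 m) (T-suc 2 m) ⟩
    8 * ((3 * suc m + 3) * S₂ m + ((3 * suc m + 2) * T 2 m + (3 * suc m + 2) * S₁ m))
      + 4 * ((3 * suc m + 1) * T 1 m) + (12 * suc m + 20) * ((3 * suc m + 2) * T 2 m) + 8 * T 1 m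
      ≡⟨ regroup m (S₂ m) (S₁ m) (T 1 m) (T 2 m) ⟩
    (3 * m + 6) * (8 * S₂ m + 4 * T 1 m + (12 * m + 20) * T 2 m) + 4 * (3 * m + 5) * (2 * S₁ m + 4 * T 2 m)
      ≡⟨ cong₂ (λ e₂ e₁ → (3 * m + 6) * e₂ + 4 * (3 * m + 5) * e₁) (S₂-closed m) (S₁-closed m) ⟩
    (3 * m + 6) * ((9 * m * m + 9 * m) * T 1 m + 8 * T 3 m) + 4 * (3 * m + 5) * ((3 * m + 4) * T 1 m)
      ≡⟨ collect m (T 1 m) (T 3 m) ⟩
    (9 * suc m * suc m + 9 * suc m) * ((3 * suc m + 1) * T 1 m) + 8 * ((3 * suc m + 3) * T 3 m) + 8 * T 1 m
      ≡⟨ cong₂ (λ t₁ t₃ → (9 * suc m * suc m + 9 * suc m) * t₁ + 8 * t₃ + 8 * T 1 m)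
               (T-suc 1 m) (T-suc 3 m) ⟨
    (9 * suc m * suc m + 9 * suc m) * T 1 (suc m) + 8 * T 3 (suc m) + 8 * T 1 m ∎)
    where
    regroup : ∀ m s₂ s₁ t₁ t₂ →
      8 * ((3 * suc m + 3) * s₂ + ((3 * suc m + 2) * t₂ + (3 * suc m + 2) * s₁))
        + 4 * ((3 * suc m + 1) * t₁) + (12 * suc m + 20) * ((3 * suc m + 2) * t₂) + 8 * t₁
      ≡ (3 * m + 6) * (8 * s₂ + 4 * t₁ + (12 * m + 20) * t₂) + 4 * (3 * m + 5) * (2 * s₁ + 4 * t₂)
    regroup = solve-∀
    collect : ∀ m t₁ t₃ →
      (3 * m + 6) * ((9 * m * m + 9 * m) * t₁ + 8 * t₃) + 4 * (3 * m + 5) * ((3 * m + 4) * t₁)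
      ≡ (9 * suc m * suc m + 9 * suc m) * ((3 * suc m + 1) * t₁) + 8 * ((3 * suc m + 3) * t₃) + 8 * t₁
    collect = solve-∀

  S₃-closed : ∀ n → 16 * S₃ n + (9 * n * n + 136 * n + 144) * T 1 n + (18 * n * n + 30 * n) * T 2 n
                    ≡ 9 * n * n * n * T 1 n + (24 * n + 48) * T 3 n + 16 * G n
  S₃-closed zero = refl
  S₃-closed (suc n) = begin
    16 * S₃ (suc n) + (9 * suc n * suc n + 136 * suc n + 144) * T 1 (suc n)
      + (18 * suc n * suc n + 30 * suc n) * T 2 (suc n)
      ≡⟨ cong₃ (λ s t₁ t₂ → 16 * s + (9 * suc n * suc n + 136 * suc n + 144) * t₁
                                    + (18 * suc n * suc n + 30 * suc n) * t₂)
               (trans (weightedSum-suc 4 middleℕ n) (cong ((3 * suc n + 4) * S₃ n +_) (middleℕ-suc n)))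
               (T-suc 1 n) (T-suc 2 n) ⟩
    16 * ((3 * suc n + 4) * S₃ n + (3 * suc n + 3) * S₂ n)
      + (9 * suc n * suc n + 136 * suc n + 144) * ((3 * suc n + 1) * T 1 n)
      + (18 * suc n * suc n + 30 * suc n) * ((3 * suc n + 2) * T 2 n)
      ≡⟨ regroup n (S₃ n) (S₂ n) (T 1 n) (T 2 n) ⟩
    (3 * n + 7) * (16 * S₃ n + (9 * n * n + 136 * n + 144) * T 1 n + (18 * n * n + 30 * n) * T 2 n)
      + 2 * (3 * n + 6) * (8 * S₂ n + 4 * T 1 n + (12 * n + 20) * T 2 n)
      + (27 * n * n + 75 * n + 100) * T 1 n
      ≡⟨ cong₂ (λ e₃ e₂ → (3 * n + 7) * e₃ + 2 * (3 * n + 6) * e₂ + (27 * n * n + 75 * n + 100) * T 1 n)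
               (S₃-closed n) (S₂-closed n) ⟩
    (3 * n + 7) * (9 * n * n * n * T 1 n + (24 * n + 48) * T 3 n + 16 * G n)
      + 2 * (3 * n + 6) * ((9 * n * n + 9 * n) * T 1 n + 8 * T 3 n) + (27 * n * n + 75 * n + 100) * T 1 n
      ≡⟨ collect n (G n) (T 1 n) (T 3 n) ⟩
    9 * suc n * suc n * suc n * ((3 * suc n + 1) * T 1 n) + (24 * suc n + 48) * ((3 * suc n + 3) * T 3 n)
      + 16 * ((3 * suc n + 4) * G n + (3 * suc n + 1) * T 1 n)
      ≡⟨ cong₃ (λ t₁ t₃ g → 9 * suc n * suc n * suc n * t₁ + (24 * suc n + 48) * t₃ + 16 * g)
               (T-suc 1 n) (T-suc 3 n)
               (trans (weightedSum-suc 4 (T 1) n) (cong ((3 * suc n + 4) * G n +_) (T-suc 1 n))) ⟨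
    9 * suc n * suc n * suc n * T 1 (suc n) + (24 * suc n + 48) * T 3 (suc n) + 16 * G (suc n) ∎
    where
    regroup : ∀ n s₃ s₂ t₁ t₂ →
      16 * ((3 * suc n + 4) * s₃ + (3 * suc n + 3) * s₂)
        + (9 * suc n * suc n + 136 * suc n + 144) * ((3 * suc n + 1) * t₁)
        + (18 * suc n * suc n + 30 * suc n) * ((3 * suc n + 2) * t₂)
      ≡ (3 * n + 7) * (16 * s₃ + (9 * n * n + 136 * n + 144) * t₁ + (18 * n * n + 30 * n) * t₂)
        + 2 * (3 * n + 6) * (8 * s₂ + 4 * t₁ + (12 * n + 20) * t₂) + (27 * n * n + 75 * n + 100) * t₁
    regroup = solve-∀
    collect : ∀ n g t₁ t₃ →
      (3 * n + 7) * (9 * n * n * n * t₁ + (24 * n + 48) * t₃ + 16 * g)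
        + 2 * (3 * n + 6) * ((9 * n * n + 9 * n) * t₁ + 8 * t₃) + (27 * n * n + 75 * n + 100) * t₁
      ≡ 9 * suc n * suc n * suc n * ((3 * suc n + 1) * t₁) + (24 * suc n + 48) * ((3 * suc n + 3) * t₃)
        + 16 * ((3 * suc n + 4) * g + (3 * suc n + 1) * t₁)
    collect = solve-∀

module Integrality where

  open import Defs
  open import Data.Nat as ℕ using (ℕ; zero; suc; _∸_; _≤_; _<_; s≤s; _≤?_)
  import Data.Nat.Properties as ℕ
  open import Data.Nat.Coprimality using (1-coprimeTo; sym)
  open import Data.Nat.Tactic.RingSolver using (solve-∀)
  open import Data.Integer as ℤ using (+_)
  import Data.Integer.Properties as ℤ
  open import Data.Rational as ℚ using (ℚ; mkℚ; toℚᵘ; 0ℚ)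
  import Data.Rational.Properties as ℚ
  open import Data.Rational.Unnormalised as ℚᵘ using (ℚᵘ; mkℚᵘ; *≡*; _≃_)
  import Data.Rational.Unnormalised.Properties as ℚᵘ
  open import Relation.Binary.PropositionalEquality as ≡ using (_≡_; refl; cong)
  open import Relation.Nullary using (yes; no; contradiction)
  open TripleFactorial
  open ClosedForms

  Σ-step : ∀ {a b} f → a ≤ b → Σ[ a ⋯ b ] f ≡ f a ℚ.+ Σ[ suc a ⋯ b ] f
  Σ-step {a} {b} f a≤b rewrite ℕ.+-∸-assoc 1 a≤b = refl

  Σ-empty : ∀ {a b} f → b < a → Σ[ a ⋯ b ] f ≡ 0ℚ
  Σ-empty f b<a rewrite ℕ.m≤n⇒m∸n≡0 b<a = refl

  ⟦_⟧ : ℕ → ℚᵘ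
  ⟦ n ⟧ = mkℚᵘ (+ n) 0

  ⟦⟧-+ : ∀ m n → ⟦ m ⟧ ℚᵘ.+ ⟦ n ⟧ ≃ ⟦ m ℕ.+ n ⟧
  ⟦⟧-+ m n = *≡* (cong (ℤ._* + 1)
    (≡.trans (≡.cong₂ ℤ._+_ (ℤ.*-identityʳ (+ m)) (ℤ.*-identityʳ (+ n))) (≡.sym (ℤ.pos-+ m n))))

  ⟦⟧-* : ∀ m n → ⟦ m ⟧ ℚᵘ.* ⟦ n ⟧ ≃ ⟦ m ℕ.* n ⟧
  ⟦⟧-* m n = *≡* (cong (ℤ._* + 1) (≡.sym (ℤ.pos-* m n)))

  exact-/tf : ∀ {x} y n → x ≡ y ℕ.* tf n → toℚᵘ (x /tf n) ≃ ⟦ y ⟧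
  exact-/tf y n refl = divide (tf n) {{tf-nonZero n}}
    where
    divide : ∀ d .{{_ : ℕ.NonZero d}} → toℚᵘ (+ (y ℕ.* d) ℚ./ d) ≃ ⟦ y ⟧
    divide (suc d) = ℚᵘ.≃-trans (ℚ.toℚᵘ-fromℚᵘ (mkℚᵘ (+ (y ℕ.* suc d)) d))
                                (*≡* (≡.trans (ℤ.*-identityʳ _) (ℤ.pos-* y (suc d))))

  Σ-toℚᵘ : ∀ n {a b} (f : ℕ → ℚ) (g : ℕ → ℕ) → suc b ∸ a ≡ n →
           (∀ {j} → a ≤ j → j ≤ b → toℚᵘ (f j) ≃ ⟦ g j ⟧) → toℚᵘ (Σ[ a ⋯ b ] f) ≃ ⟦ sumFrom a n g ⟧
  Σ-toℚᵘ n {a} {b} f g count f≃g with a ≤? b | n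
  ... | yes a≤b | zero = contradiction (≡.trans (≡.sym (ℕ.+-∸-assoc 1 a≤b)) count) λ ()
  ... | yes a≤b | suc n = begin
    toℚᵘ (Σ[ a ⋯ b ] f)                          ≡⟨ cong toℚᵘ (Σ-step f a≤b) ⟩
    toℚᵘ (f a ℚ.+ Σ[ suc a ⋯ b ] f)              ≈⟨ ℚ.toℚᵘ-homo-+ (f a) _ ⟩
    toℚᵘ (f a) ℚᵘ.+ toℚᵘ (Σ[ suc a ⋯ b ] f)
      ≈⟨ ℚᵘ.+-cong (f≃g ℕ.≤-refl a≤b) (Σ-toℚᵘ n f g b∸a≡n (λ a<j → f≃g (ℕ.<⇒≤ a<j))) ⟩
    ⟦ g a ⟧ ℚᵘ.+ ⟦ sumFrom (suc a) n g ⟧         ≈⟨ ⟦⟧-+ (g a) _ ⟩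
    ⟦ sumFrom a (suc n) g ⟧                       ∎
    where
    open ℚᵘ.≃-Reasoning
    b∸a≡n : b ∸ a ≡ n
    b∸a≡n = ℕ.suc-injective (≡.trans (≡.sym (ℕ.+-∸-assoc 1 a≤b)) count)
  ... | no a≰b | zero = ℚᵘ.≃-reflexive (cong toℚᵘ (Σ-empty f (ℕ.≰⇒> a≰b)))
  ... | no a≰b | suc n = contradiction (≡.trans (≡.sym (ℕ.m≤n⇒m∸n≡0 (ℕ.≰⇒> a≰b))) count) λ ()

  inner-toℚᵘ : ∀ n → toℚᵘ (inner n) ≃ ⟦ innerℕ n ⟧
  inner-toℚᵘ n = begin
    toℚᵘ (inner n)
      ≈⟨ ℚ.toℚᵘ-homo-+ (T 2 n /tf 0) (Σ[ 1 ⋯ n ∸ 1 ] summand) ⟩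
    toℚᵘ (T 2 n /tf 0) ℚᵘ.+ toℚᵘ (Σ[ 1 ⋯ n ∸ 1 ] summand)
      ≈⟨ ℚᵘ.+-cong (exact-/tf (T 2 n) 0 (≡.sym (ℕ.*-identityʳ (T 2 n))))
                   (Σ-toℚᵘ (n ∸ 1) summand (λ j → tfRatio 2 j n ℕ.* T 1 j) refl summand-integral) ⟩
    ⟦ T 2 n ⟧ ℚᵘ.+ ⟦ sumFrom 1 (n ∸ 1) (λ j → tfRatio 2 j n ℕ.* T 1 j) ⟧ ≈⟨ ⟦⟧-+ (T 2 n) _ ⟩
    ⟦ innerℕ n ⟧                                            ∎
    where
    open ℚᵘ.≃-Reasoning
    open import Algebra.Properties.CommutativeSemigroup ℕ.*-commutativeSemigroup using (x∙yz≈yx∙z)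
    summand : ℕ → ℚ
    summand j = (tf (3 ℕ.* j ℕ.+ 1) ℕ.* tf (3 ℕ.* n ℕ.+ 2)) /tf (3 ℕ.* j ℕ.+ 2)
    summand-integral : ∀ {j} → 1 ≤ j → j ≤ n ∸ 1 → toℚᵘ (summand j) ≃ ⟦ tfRatio 2 j n ℕ.* T 1 j ⟧
    summand-integral {j} _ j≤n-1 = exact-/tf (tfRatio 2 j n ℕ.* T 1 j) (3 ℕ.* j ℕ.+ 2)
      (≡.trans (cong (T 1 j ℕ.*_) (T≡tfRatio*T 2 (ℕ.≤-trans j≤n-1 (ℕ.m∸n≤m n 1))))
               (x∙yz≈yx∙z (T 1 j) (tfRatio 2 j n) (T 2 j)))

  middle-toℚᵘ : ∀ r → toℚᵘ (Σ[ 1 ⋯ r ∸ 1 ] (λ n → (tf (3 ℕ.* r ℕ.+ 3) /tf (3 ℕ.* n ℕ.+ 3)) ℚ.* inner n))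
                      ≃ ⟦ middleℕ r ⟧
  middle-toℚᵘ r = Σ-toℚᵘ (r ∸ 1) _ (λ n → tfRatio 3 n r ℕ.* innerℕ n) refl summand-integral
    where
    open ℚᵘ.≃-Reasoning
    summand-integral : ∀ {n} → 1 ≤ n → n ≤ r ∸ 1 →
      toℚᵘ ((tf (3 ℕ.* r ℕ.+ 3) /tf (3 ℕ.* n ℕ.+ 3)) ℚ.* inner n) ≃ ⟦ tfRatio 3 n r ℕ.* innerℕ n ⟧
    summand-integral {n} _ n≤r-1 = begin
      toℚᵘ ((T 3 r /tf (3 ℕ.* n ℕ.+ 3)) ℚ.* inner n)
        ≈⟨ ℚ.toℚᵘ-homo-* (T 3 r /tf (3 ℕ.* n ℕ.+ 3)) (inner n) ⟩
      toℚᵘ (T 3 r /tf (3 ℕ.* n ℕ.+ 3)) ℚᵘ.* toℚᵘ (inner n)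
        ≈⟨ ℚᵘ.*-cong (exact-/tf (tfRatio 3 n r) (3 ℕ.* n ℕ.+ 3) (T≡tfRatio*T 3 (ℕ.≤-trans n≤r-1 (ℕ.m∸n≤m r 1))))
                     (inner-toℚᵘ n) ⟩
      ⟦ tfRatio 3 n r ⟧ ℚᵘ.* ⟦ innerℕ n ⟧               ≈⟨ ⟦⟧-* (tfRatio 3 n r) (innerℕ n) ⟩
      ⟦ tfRatio 3 n r ℕ.* innerℕ n ⟧                    ∎

  ≤∸1⇒< : ∀ {m n} → 1 ≤ m → m ≤ n ∸ 1 → m < n
  ≤∸1⇒< {n = zero} 1≤m m≤0 = contradiction (ℕ.≤-trans 1≤m m≤0) λ ()
  ≤∸1⇒< {n = suc n} _ m≤n = s≤s m≤n

  β-toℚᵘ : ∀ p → toℚᵘ (β p) ≃ ⟦ βℕ p ⟧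
  β-toℚᵘ p = Σ-toℚᵘ (p ∸ 1) _ (λ r → tfRatio 1 (suc r) p ℕ.* middleℕ r) refl summand-integral
    where
    open ℚᵘ.≃-Reasoning
    middle : ℕ → ℚ
    middle r = Σ[ 1 ⋯ r ∸ 1 ] (λ n → (tf (3 ℕ.* r ℕ.+ 3) /tf (3 ℕ.* n ℕ.+ 3)) ℚ.* inner n)
    3[1+r]+1≡3r+4 : ∀ r → 3 ℕ.* suc r ℕ.+ 1 ≡ 3 ℕ.* r ℕ.+ 4
    3[1+r]+1≡3r+4 = solve-∀
    summand-integral : ∀ {r} → 1 ≤ r → r ≤ p ∸ 1 →
      toℚᵘ ((tf (3 ℕ.* p ℕ.+ 1) /tf (3 ℕ.* r ℕ.+ 4)) ℚ.* middle r) ≃ ⟦ tfRatio 1 (suc r) p ℕ.* middleℕ r ⟧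
    summand-integral {r} 1≤r r≤p-1 = begin
      toℚᵘ ((T 1 p /tf (3 ℕ.* r ℕ.+ 4)) ℚ.* middle r)
        ≈⟨ ℚ.toℚᵘ-homo-* (T 1 p /tf (3 ℕ.* r ℕ.+ 4)) (middle r) ⟩
      toℚᵘ (T 1 p /tf (3 ℕ.* r ℕ.+ 4)) ℚᵘ.* toℚᵘ (middle r)
        ≈⟨ ℚᵘ.*-cong (exact-/tf (tfRatio 1 (suc r) p) (3 ℕ.* r ℕ.+ 4) T₁p≡ratio*tf) (middle-toℚᵘ r) ⟩
      ⟦ tfRatio 1 (suc r) p ⟧ ℚᵘ.* ⟦ middleℕ r ⟧       ≈⟨ ⟦⟧-* (tfRatio 1 (suc r) p) (middleℕ r) ⟩
      ⟦ tfRatio 1 (suc r) p ℕ.* middleℕ r ⟧            ∎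
      where
      T₁p≡ratio*tf : T 1 p ≡ tfRatio 1 (suc r) p ℕ.* tf (3 ℕ.* r ℕ.+ 4)
      T₁p≡ratio*tf = ≡.trans (T≡tfRatio*T 1 (≤∸1⇒< {n = p} 1≤r r≤p-1))
                             (cong (λ m → tfRatio 1 (suc r) p ℕ.* tf m) (3[1+r]+1≡3r+4 r))

  β≡βℕ : ∀ p → β p ≡ mkℚ (+ βℕ p) 0 (sym (1-coprimeTo (βℕ p)))
  β≡βℕ p = ℚ.toℚᵘ-injective (β-toℚᵘ p)

module Residue where

  open import Data.Nat as ℕ using (ℕ; zero; suc; _<_; _≤_; z≤n; s≤s; z<s)
  import Data.Nat.Properties as ℕ
  open import Data.Nat.Divisibility as ℕ∣ using () renaming (_∣_ to _∣ℕ_)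
  open import Data.Nat.Primality using (Prime; ¬prime[0])
  open import Data.Nat.Tactic.RingSolver using (solve-∀)
  open import Data.Integer as ℤ using (+_; 0ℤ; 1ℤ; -1ℤ; _+_; _*_)
  import Data.Integer.Properties as ℤ
  open import Data.Integer.Divisibility.Signed using (_∣_; ∣ᵤ⇒∣; ∣⇒∣ᵤ)
  open import Data.Product using (Σ; _×_; _,_)
  open import Data.Sum using (inj₁; inj₂)
  open import Relation.Binary.Definitions using (tri<; tri≈; tri>)
  open import Relation.Binary.PropositionalEquality as ≡ using (_≡_; _≢_; cong; cong₂; subst)
  open import Relation.Nullary using (¬_; contradiction)
  open Modular
  open TripleFactorial
  open ClosedForms

  module _ {m : ℕ} where

    open Congruence m

    sumFrom-single : ∀ i n {g j₀} → i ≤ j₀ → j₀ < i ℕ.+ n →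
                     (∀ {j} → i ≤ j → j < i ℕ.+ n → j ≢ j₀ → m ∣ℕ g j) → + sumFrom i n g ≡ + g j₀ mod m
    sumFrom-single i zero i≤j₀ j₀<i+0 _ =
      contradiction i≤j₀ (ℕ.<⇒≱ (subst (_ <_) (ℕ.+-identityʳ i) j₀<i+0))
    sumFrom-single i (suc n) {g} {j₀} i≤j₀ j₀<i+1+n m∣g with ℕ.m≤n⇒m<n∨m≡n i≤j₀
    ... | inj₂ ≡.refl = trans (reflexive (cong +_ (ℕ.+-comm (g i) _)))
      (multiple+≡ (sumFrom (suc i) n g) (g i) (∣-sumFrom (suc i) n (λ {j} i<j j<1+i+n →
        range-tail m∣g i<j j<1+i+n (λ j≡i → ℕ.<⇒≢ i<j (≡.sym j≡i)))))
    ... | inj₁ i<j₀ =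
      trans (multiple+≡ (g i) (sumFrom (suc i) n g) (m∣g ℕ.≤-refl (ℕ.m<m+n i z<s) (ℕ.<⇒≢ i<j₀)))
            (sumFrom-single (suc i) n i<j₀ (subst (j₀ <_) (ℕ.+-suc i n) j₀<i+1+n) (range-tail m∣g))

  module _ {N : ℕ} (p-prime : Prime (suc N)) (3<p : 3 < suc N) where

    private
      p : ℕ
      p = suc N

    open Congruence p
    open Product *-1-commutativeMonoid using (∏<)
    import Relation.Binary.Reasoning.Setoid setoid as ≋-Reasoning

    private
      p∤3 : ¬ (+ p ∣ + 3)
      p∤3 p∣3 = ℕ∣.>⇒∤ 3<p (∣⇒∣ᵤ p∣3)

      p∤2ⁿ : ∀ n → ¬ (p ∣ℕ 2 ℕ.^ n)
      p∤2ⁿ = p∤2^ p-prime (ℕ.<-trans (ℕ.n<1+n 2) 3<p)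

      3j+c≡ : ∀ j c → + 3 * + j + + c ≡ + (3 ℕ.* j ℕ.+ c)
      3j+c≡ j c = ≡.sym (≡.trans (ℤ.pos-+ (3 ℕ.* j) c) (cong (_+ + c) (ℤ.pos-* 3 j)))

      positive-root : ∀ c → ¬ (p ∣ℕ c) → Σ ℕ λ K → suc K < p × p ∣ℕ 3 ℕ.* suc K ℕ.+ c
      positive-root c p∤c = positive (Progression.solve p-prime (+ 3) (+ c) p∤3 0ℤ)
        where
        positive : Σ ℕ (λ j → j < p × + 3 * + j + + c ≡ 0ℤ mod p) →
                   Σ ℕ λ K → suc K < p × p ∣ℕ 3 ℕ.* suc K ℕ.+ c
        positive (zero , _ , c≡0) = contradiction (∣⇒∣ᵤ (≡0⇒∣ c≡0)) p∤c
        positive (suc K , 1+K<p , root) = K , 1+K<p , ∣⇒∣ᵤ (subst (+ p ∣_) (3j+c≡ (suc K) c) (≡0⇒∣ root))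

    open Progression p-prime (+ 3) (+ 1) p∤3 using (term; termExcept; termExcept-self; termExcept-other; wilson)

    module Roots {K K′ : ℕ} (k<p : suc K < p) (p∣3k+1 : p ∣ℕ 3 ℕ.* suc K ℕ.+ 1)
                 (k′<p : suc K′ < p) (p∣3k′+2 : p ∣ℕ 3 ℕ.* suc K′ ℕ.+ 2) where

      private
        k : ℕ
        k = suc K

        k≤N : k ≤ N
        k≤N = ℕ.s≤s⁻¹ k<p

        1≤K : 1 ≤ K
        1≤K = positive K p∣3k+1
          where
          positive : ∀ K → p ∣ℕ 3 ℕ.* suc K ℕ.+ 1 → 1 ≤ K
          positive zero p∣4 = contradiction p∣4 (p∤2ⁿ 2)
          positive (suc _) _ = s≤s z≤n

        term≡ : ∀ i → term i ≡ + (3 ℕ.* i ℕ.+ 1)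
        term≡ i = 3j+c≡ i 1

        ∏<-below : ∀ n → n < k → ∏< (suc n) (termExcept k) ≡ + T 1 n
        ∏<-below zero _ = cong (1ℤ *_) (termExcept-other {k} {0} λ ())
        ∏<-below (suc n) 1+n<k = begin
          ∏< (suc n) (termExcept k) * termExcept k (suc n)
            ≡⟨ cong₂ _*_ (∏<-below n (ℕ.<-trans (ℕ.n<1+n n) 1+n<k))
                         (≡.trans (termExcept-other {k} {suc n} (ℕ.<⇒≢ 1+n<k)) (term≡ (suc n))) ⟩
          + T 1 n * + (3 ℕ.* suc n ℕ.+ 1)   ≡⟨ ℤ.pos-* (T 1 n) (3 ℕ.* suc n ℕ.+ 1) ⟨
          + (T 1 n ℕ.* (3 ℕ.* suc n ℕ.+ 1))
            ≡⟨ cong +_ (≡.trans (ℕ.*-comm (T 1 n) (3 ℕ.* suc n ℕ.+ 1)) (≡.sym (T-suc 1 n))) ⟩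
          + T 1 (suc n)                    ∎
          where open ≡.≡-Reasoning

        ∏<-above : ∀ n → k ≤ n → ∏< (suc n) (termExcept k) ≡ + (tfRatio 1 k n ℕ.* T 1 K)
        ∏<-above n k≤n with ℕ.m≤n⇒m<n∨m≡n k≤n
        ... | inj₂ ≡.refl = begin
          ∏< k (termExcept k) * termExcept k k ≡⟨ cong₂ _*_ (∏<-below K (ℕ.n<1+n K)) (termExcept-self k) ⟩
          + T 1 K * 1ℤ                         ≡⟨ ℤ.*-identityʳ (+ T 1 K) ⟩
          + T 1 K                              ≡⟨ cong +_ (ℕ.*-identityˡ (T 1 K)) ⟨
          + (1 ℕ.* T 1 K)                      ≡⟨ cong (λ r → + (r ℕ.* T 1 K)) (tfRatio-self 1 k) ⟨
          + (tfRatio 1 k k ℕ.* T 1 K)          ∎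
          where open ≡.≡-Reasoning
        ∏<-above (suc n) _ | inj₁ (s≤s k≤n) = begin
          ∏< (suc n) (termExcept k) * termExcept k (suc n)
            ≡⟨ cong₂ _*_ (∏<-above n k≤n)
                         (≡.trans (termExcept-other {k} {suc n} (λ 1+n≡k → ℕ.<-irrefl (≡.sym 1+n≡k) (s≤s k≤n)))
                                  (term≡ (suc n))) ⟩
          + (tfRatio 1 k n ℕ.* T 1 K) * + (3 ℕ.* suc n ℕ.+ 1)
            ≡⟨ ℤ.pos-* (tfRatio 1 k n ℕ.* T 1 K) (3 ℕ.* suc n ℕ.+ 1) ⟨
          + (tfRatio 1 k n ℕ.* T 1 K ℕ.* (3 ℕ.* suc n ℕ.+ 1))
            ≡⟨ cong +_ (xy∙z≈zx∙y (tfRatio 1 k n) (T 1 K) (3 ℕ.* suc n ℕ.+ 1)) ⟩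
          + ((3 ℕ.* suc n ℕ.+ 1) ℕ.* tfRatio 1 k n ℕ.* T 1 K)   ≡⟨ cong (λ r → + (r ℕ.* T 1 K)) (tfRatio-suc 1 k≤n) ⟨
          + (tfRatio 1 k (suc n) ℕ.* T 1 K)                     ∎
          where
          open ≡.≡-Reasoning
          open import Algebra.Properties.CommutativeSemigroup ℕ.*-commutativeSemigroup using (xy∙z≈zx∙y)

        special-summand : + (tfRatio 4 K N ℕ.* T 1 K) ≡ -1ℤ mod p
        special-summand = begin
          + (tfRatio 4 K N ℕ.* T 1 K)
            ≡⟨ cong (λ r → + (r ℕ.* T 1 K)) (≡.trans (≡.sym (tfRatio-shift 1 K N)) (tfRatio-suc 1 k≤N)) ⟩
          + ((3 ℕ.* p ℕ.+ 1) ℕ.* tfRatio 1 k N ℕ.* T 1 K)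
            ≡⟨ cong +_ (ℕ.*-assoc (3 ℕ.* p ℕ.+ 1) (tfRatio 1 k N) (T 1 K)) ⟩
          + ((3 ℕ.* p ℕ.+ 1) ℕ.* (tfRatio 1 k N ℕ.* T 1 K))
            ≡⟨ ℤ.pos-* (3 ℕ.* p ℕ.+ 1) (tfRatio 1 k N ℕ.* T 1 K) ⟩
          + (3 ℕ.* p ℕ.+ 1) * + (tfRatio 1 k N ℕ.* T 1 K)     ≡⟨ cong (+ (3 ℕ.* p ℕ.+ 1) *_) (∏<-above N k≤N) ⟨
          + (3 ℕ.* p ℕ.+ 1) * ∏< p (termExcept k)
            ≈⟨ *-cong (multiple+≡ (3 ℕ.* p) 1 (ℕ∣.∣n⇒∣m*n 3 ℕ∣.∣-refl)) (wilson k<p (∣⇒≡0 p∣tk)) ⟩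
          1ℤ * -1ℤ                                            ∎
          where
          open ≋-Reasoning
          p∣tk : + p ∣ term k
          p∣tk = subst (+ p ∣_) (≡.sym (term≡ k)) (∣ᵤ⇒∣ {+ p} {+ (3 ℕ.* k ℕ.+ 1)} p∣3k+1)

        G≡-1 : + G N ≡ -1ℤ mod p
        G≡-1 = trans (sumFrom-single 1 N 1≤K (ℕ.<-trans (ℕ.n<1+n K) k<p) p∣other-summand) special-summand
          where
          3K+4≡3k+1 : ∀ K → 3 ℕ.* K ℕ.+ 4 ≡ 3 ℕ.* suc K ℕ.+ 1
          3K+4≡3k+1 = solve-∀
          p∣other-summand : ∀ {s} → 1 ≤ s → s < suc N → s ≢ K → p ∣ℕ tfRatio 4 s N ℕ.* T 1 s
          p∣other-summand {s} _ _ s≢K with ℕ.<-cmp s K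
          ... | tri< s<K _ _ = ℕ∣.∣m⇒∣m*n (T 1 s)
                  (ℕ∣.∣-trans (subst (p ∣ℕ_) (≡.sym (3K+4≡3k+1 K)) p∣3k+1) (factor∣tfRatio 4 s<K (ℕ.<⇒≤ k≤N)))
          ... | tri≈ _ s≡K _ = contradiction s≡K s≢K
          ... | tri> _ _ K<s = ℕ∣.∣n⇒∣m*n (tfRatio 4 s N) (ℕ∣.∣-trans p∣3k+1 (factor∣T 1 K<s))

      S₃≡-1 : + S₃ N ≡ -1ℤ mod p
      S₃≡-1 = *-cancelˡ p-prime { + 16 } { + S₃ N } { -1ℤ } (λ p∣16 → p∤2ⁿ 4 (∣⇒∣ᵤ p∣16)) (begin
        + 16 * + S₃ N         ≡⟨ ℤ.pos-* 16 (S₃ N) ⟨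
        + (16 ℕ.* S₃ N)       ≈⟨ multiple+≡ X (16 ℕ.* S₃ N) p∣X ⟨
        + (X ℕ.+ 16 ℕ.* S₃ N)
          ≡⟨ cong +_ (≡.trans (ℕ.+-comm X (16 ℕ.* S₃ N))
                              (≡.trans (≡.sym (ℕ.+-assoc (16 ℕ.* S₃ N) (a₁ ℕ.* T 1 N) (a₂ ℕ.* T 2 N))) (S₃-closed N))) ⟩
        + (Y ℕ.+ 16 ℕ.* G N)  ≈⟨ multiple+≡ Y (16 ℕ.* G N) p∣Y ⟩
        + (16 ℕ.* G N)        ≡⟨ ℤ.pos-* 16 (G N) ⟩
        + 16 * + G N          ≈⟨ *-cong (refl {+ 16}) G≡-1 ⟩
        + 16 * -1ℤ            ∎)
        where
        open ≋-Reasoning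
        p∣T₁ : p ∣ℕ T 1 N
        p∣T₁ = ℕ∣.∣-trans p∣3k+1 (factor∣T 1 k≤N)
        p∣T₂ : p ∣ℕ T 2 N
        p∣T₂ = ℕ∣.∣-trans p∣3k′+2 (factor∣T 2 (ℕ.s≤s⁻¹ k′<p))
        a₁ a₂ b₁ b₃ X Y : ℕ
        a₁ = 9 ℕ.* N ℕ.* N ℕ.+ 136 ℕ.* N ℕ.+ 144
        a₂ = 18 ℕ.* N ℕ.* N ℕ.+ 30 ℕ.* N
        b₁ = 9 ℕ.* N ℕ.* N ℕ.* N
        b₃ = 24 ℕ.* N ℕ.+ 48
        X = a₁ ℕ.* T 1 N ℕ.+ a₂ ℕ.* T 2 N
        Y = b₁ ℕ.* T 1 N ℕ.+ b₃ ℕ.* T 3 N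
        p∣X : p ∣ℕ X
        p∣X = ℕ∣.∣m∣n⇒∣m+n (ℕ∣.∣n⇒∣m*n a₁ p∣T₁) (ℕ∣.∣n⇒∣m*n a₂ p∣T₂)
        p∣Y : p ∣ℕ Y
        p∣Y = ℕ∣.∣m∣n⇒∣m+n (ℕ∣.∣n⇒∣m*n b₁ p∣T₁) (ℕ∣.∣n⇒∣m*n b₃ (suc∣T₃ N))

    S₃≡-1 : + S₃ N ≡ -1ℤ mod p
    S₃≡-1 =
      let (_ , k<p , p∣3k+1) = positive-root 1 (p∤2ⁿ 0)
          (_ , k′<p , p∣3k′+2) = positive-root 2 (p∤2ⁿ 1)
      in Roots.S₃≡-1 k<p p∣3k+1 k′<p p∣3k′+2

  p∣βℕ+1 : ∀ {p} → Prime p → 3 < p → p ∣ℕ βℕ p ℕ.+ 1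
  p∣βℕ+1 {zero} p-prime _ = contradiction p-prime ¬prime[0]
  p∣βℕ+1 {suc N} p-prime 3<p = subst (λ b → suc N ∣ℕ b ℕ.+ 1) (≡.sym (βℕ-suc N)) p∣S₃+1
    where
    p∣S₃+1 : suc N ∣ℕ S₃ N ℕ.+ 1
    p∣S₃+1 = ∣⇒∣ᵤ {+ suc N} {+ S₃ N + 1ℤ} (divides-difference (S₃≡-1 p-prime 3<p))

open import Defs
open import Data.Nat using (ℕ; _>_)
open import Data.Nat.Primality using (Prime)
open import Data.Integer using (+_; _+_)
open import Data.Integer.Divisibility using (_∣_)
open import Data.Rational using (↥_; ↧_)
open import Data.Product using (_×_)
open import Relation.Nullary using (¬_)
open import Data.Nat using (s≤s; z≤n)
open import Data.Nat.Properties using (<-trans)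
open import Data.Nat.Divisibility using (>⇒∤)
open import Data.Product using (_,_)
open import Relation.Binary.PropositionalEquality using (subst; sym)
open Integrality using (β≡βℕ)
open Residue using (p∣βℕ+1)

proposition2 : (p : ℕ) → Prime p → p > 3 →
    (¬ ((+ p) ∣ (↧ β p))) × ((+ p) ∣ ((↥ β p) + (↧ β p)))
proposition2 p p-prime 3<p = subst (λ q → ¬ (+ p ∣ ↧ q) × (+ p ∣ ↥ q + ↧ q)) (sym (β≡βℕ p))
  (>⇒∤ (<-trans (s≤s (s≤s z≤n)) 3<p) , p∣βℕ+1 p-prime 3<p)
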